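{- There is an algorithm which, given a partial multiplication matrix $M$ (with its row and column signs) and a monadic second-order sentence $\theta$ in the language $\{<_1,<_2\}$, decides whether $\theta\in Th(\mathrm{Geom}(M))$, i.e. whether every permutation in $\mathrm{Geom}(M)$ satisfies $\theta$.
   Context: A (finite) permutation is a finite set with two linear orders $<_1,<_2$. A finite point set in the plane with distinct $x$- and $y$-coordinates determines a permutation ($<_1$ left-to-right, $<_2$ bottom-to-top). For a finite matrix $M$ with entries in $\{0,1,-1\}$, in the grid of unit cells draw in each cell with entry $1$ the open segment from bottom-left to top-right corner, in each cell with entry $-1$ the open segment from top-left to bottom-right, nothing for entry $0$; $\mathrm{Geom}(M)$ is the set of finite permutations determined by finite point sets on this figure. $M$ is a partial multiplication matrix if each row and each column can be assigned a sign in $\{1,-1\}$ so that every nonzero entry equals the product of its row sign and column sign. Monadic second-order logic in $\{<_1,<_2\}$: formulas with element and set variables, atomic formulas $x<_1y$, $x<_2y$, $x=y$, $x\in X$, Boolean connectives, quantification over elements and subsets. $Th(\mathcal{C})$ is the set of sentences true in every member of $\mathcal{C}$.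
   Formalization: The finite point sets on the figure of $M$ that define $\mathrm{Geom}(M)$ are taken with rational coordinates. -}

module Defs where

open import Data.Nat using (ℕ; suc)
open import Data.Fin using (Fin; toℕ)
open import Data.Fin.Subset using (Subset; _∈_)
open import Data.Integer using (+_)
open import Data.Rational using (ℚ; _<_; _+_; _-_; _/_; 0ℚ; 1ℚ)
open import Data.Product using (Σ; _×_; _,_; proj₁; proj₂)
open import Data.Sum using (_⊎_)
open import Relation.Binary.PropositionalEquality using (_≡_; _≢_)
open import Relation.Nullary using (¬_)

data Entry : Set where
  e0 e1 e-1 : Entry

data Sign : Set where
  s+ s- : Sign

signEntry : Sign → Entry
signEntry s+ = e1
signEntry s- = e-1

_·_ : Sign → Sign → Sign
s+ · t = t
s- · s+ = s-
s- · s- = s+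

-- A w × h matrix, indexed by (column, row); column 0 is leftmost and
-- row 0 is the bottom row, so the entry M c r sits in the unit cell
-- [c, c+1] × [r, r+1] of the plane.
Matrix : ℕ → ℕ → Set
Matrix w h = Fin w → Fin h → Entry

IsPMMWith : ∀ {w h} → Matrix w h → (Fin w → Sign) → (Fin h → Sign) → Set
IsPMMWith M cs rs = ∀ c r → M c r ≢ e0 → M c r ≡ signEntry (rs r · cs c)

IsPMM : ∀ {w h} → Matrix w h → Set
IsPMM {w} {h} M = Σ (Fin w → Sign) λ cs → Σ (Fin h → Sign) λ rs → IsPMMWith M cs rs

ℕtoℚ : ℕ → ℚ
ℕtoℚ n = + n / 1

OnCell : ∀ {w h} → Matrix w h → Fin w → Fin h → ℚ × ℚ → Set
OnCell M c r (x , y) =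
  Σ ℚ λ t → (0ℚ < t) × (t < 1ℚ) × (x ≡ ℕtoℚ (toℕ c) + t) ×
    ((M c r ≡ e1 × y ≡ ℕtoℚ (toℕ r) + t)
     ⊎ (M c r ≡ e-1 × y ≡ (ℕtoℚ (toℕ r) + 1ℚ) - t))

OnFigure : ∀ {w h} → Matrix w h → ℚ × ℚ → Set
OnFigure {w} {h} M p = Σ (Fin w) λ c → Σ (Fin h) λ r → OnCell M c r p

record Perm : Set₁ where
  field
    size : ℕ
    _<₁_ : Fin size → Fin size → Set
    _<₂_ : Fin size → Fin size → Set

record GeomPointSet {w h} (M : Matrix w h) : Set where
  field
    n      : ℕ
    pt     : Fin n → ℚ × ℚ
    onFig  : ∀ i → OnFigure M (pt i)
    distX  : ∀ i j → i ≢ j → proj₁ (pt i) ≢ proj₁ (pt j)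
    distY  : ∀ i j → i ≢ j → proj₂ (pt i) ≢ proj₂ (pt j)

permOf : ∀ {w h} {M : Matrix w h} → GeomPointSet M → Perm
permOf P = record
  { size = GeomPointSet.n P
  ; _<₁_ = λ i j → proj₁ (GeomPointSet.pt P i) < proj₁ (GeomPointSet.pt P j)
  ; _<₂_ = λ i j → proj₂ (GeomPointSet.pt P i) < proj₂ (GeomPointSet.pt P j)
  }

-- Monadic second-order logic over {<₁, <₂}
-- Formula e s: e free element variables, s free set variables (de Bruijn)

data Formula : ℕ → ℕ → Set where
  lt₁ lt₂ eq : ∀ {e s} → Fin e → Fin e → Formula e s
  mem        : ∀ {e s} → Fin e → Fin s → Formula e s
  ff         : ∀ {e s} → Formula e s
  neg        : ∀ {e s} → Formula e s → Formula e s
  and or imp : ∀ {e s} → Formula e s → Formula e s → Formula e s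
  exE allE   : ∀ {e s} → Formula (suc e) s → Formula e s
  exS allS   : ∀ {e s} → Formula e (suc s) → Formula e s

Sentence : Set
Sentence = Formula 0 0

extend : ∀ {k} {A : Set} → A → (Fin k → A) → Fin (suc k) → A
extend a f Fin.zero = a
extend a f (Fin.suc i) = f i

Sat : (π : Perm) → ∀ {e s} → Formula e s →
      (Fin e → Fin (Perm.size π)) → (Fin s → Subset (Perm.size π)) → Set
Sat π (lt₁ x y) ρ σ = Perm._<₁_ π (ρ x) (ρ y)
Sat π (lt₂ x y) ρ σ = Perm._<₂_ π (ρ x) (ρ y)
Sat π (eq x y)  ρ σ = ρ x ≡ ρ y
Sat π (mem x X) ρ σ = ρ x ∈ σ X
Sat π ff        ρ σ = Data.Empty.⊥
  where import Data.Empty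
Sat π (neg φ)   ρ σ = ¬ Sat π φ ρ σ
Sat π (and φ ψ) ρ σ = Sat π φ ρ σ × Sat π ψ ρ σ
Sat π (or φ ψ)  ρ σ = Sat π φ ρ σ ⊎ Sat π ψ ρ σ
Sat π (imp φ ψ) ρ σ = Sat π φ ρ σ → Sat π ψ ρ σ
Sat π (exE φ)   ρ σ = Σ (Fin (Perm.size π)) λ a → Sat π φ (extend a ρ) σ
Sat π (allE φ)  ρ σ = ∀ a → Sat π φ (extend a ρ) σ
Sat π (exS φ)   ρ σ = Σ (Subset (Perm.size π)) λ A → Sat π φ ρ (extend A σ)
Sat π (allS φ)  ρ σ = ∀ A → Sat π φ ρ (extend A σ)

_⊨_ : Perm → Sentence → Set
π ⊨ θ = Sat π θ (λ ()) (λ ())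

InThGeom : ∀ {w h} → Sentence → Matrix w h → Set
InThGeom θ M = ∀ (P : GeomPointSet M) → permOf P ⊨ θ

-- The points of the figure of M can be given one parameter u ∈ (0,1) on each segment such that,
-- within a column, the x-order of points is their u-order or its reverse according to the column
-- sign, and within a row the y-order is the u-order or its reverse according to the row sign; this
-- is exactly what the partial multiplication property provides.  Listing the cells of the points of
-- a point set in the order of u therefore gives a word over the nonzero cells that determines its
-- permutation up to isomorphism, and every such word is realised by a point set.  So θ ∈ Th(Geom(M))
-- iff θ holds in the permutations of all words over nonzero cells.  As in Büchi's theorem, a monadic
-- second-order formula about these permutations translates into a finite automaton on words
-- annotated with the values of the free variables (atoms compare cells and positions, quantifiers
-- become projections), and emptiness of the automaton for "nonzero cells and not θ" is decidable.

module Submission where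

open import Defs
open import Data.Nat as ℕ using (ℕ; zero; suc)
import Data.Nat.Properties as ℕP
open import Data.Fin as F using (Fin; zero; suc; toℕ)
import Data.Fin.Properties as FP
open import Data.Fin.Subset using (Subset; _∈_)
open import Data.Bool using (Bool; true; false; _∧_; _∨_; not; T)
open import Data.Bool.Properties using (T-∧; T-∨; T-≡)
open import Data.Empty using (⊥-elim)
open import Data.Product using (Σ; ∃; ∃₂; _×_; _,_; proj₁; proj₂)
open import Data.Product.Function.NonDependent.Propositional using (_×-⇔_)
open import Data.Sum using (_⊎_; inj₁; inj₂)
open import Data.Sum.Function.Propositional using (_⊎-⇔_)
open import Data.Vec as V using (Vec; []; _∷_; lookup; tabulate)
import Data.Vec.Properties as VP
open import Function using (_∘_)
open import Function.Bundles using (_↔_; _⇔_; mk↔ₛ′; mk⇔; Inverse; Equivalence)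
import Function.Properties.Equivalence as ⇔
open import Function.Construct.Identity using (↔-id)
open import Function.Related.TypeIsomorphisms using (→-cong-⇔; ¬-cong-⇔)
open import Function.Related.Propositional using (equivalence)
import Data.Product.Function.Dependent.Propositional as Σ
open import Relation.Binary.PropositionalEquality
open import Relation.Binary.Definitions using (tri<; tri≈; tri>)
open import Relation.Nullary using (Dec; yes; no; ¬_)
open import Relation.Nullary.Decidable using (⌊_⌋; toWitness; fromWitness; T?; decidable-stable; ¬?)
import Relation.Nullary.Decidable as Decidable
open import Relation.Nullary.Negation using (∀⟶¬∃¬; ¬∃⟶∀¬)

open Equivalence using (to; from)

Oriented : Sign → ∀ {A : Set} → (A → A → Set) → A → A → Set
Oriented s+ _<_ a b = a < b
Oriented s- _<_ a b = b < a

∃-cong-↔ : ∀ {A B : Set} {P : A → Set} {Q : B → Set} (e : A ↔ B) →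
           (∀ {a} → P a ⇔ Q (Inverse.to e a)) → Σ A P ⇔ Σ B Q
∃-cong-↔ = Σ.cong {k = equivalence}

∀-cong-↔ : ∀ {A B : Set} {P : A → Set} {Q : B → Set} (e : A ↔ B) →
           (∀ {a} → P a ⇔ Q (Inverse.to e a)) → (∀ a → P a) ⇔ (∀ b → Q b)
∀-cong-↔ {Q = Q} e P⇔Q = mk⇔ (λ p b → subst Q (I.strictlyInverseˡ b) (to P⇔Q (p (I.from b))))
  (λ q a → from P⇔Q (q (I.to a)))
  where module I = Inverse e

∀⇔¬∃¬ : ∀ {A : Set} {P : A → Set} → (∀ a → Dec (P a)) → (∀ a → P a) ⇔ (¬ ∃ λ a → ¬ P a)
∀⇔¬∃¬ P? = mk⇔ ∀⟶¬∃¬ (λ h a → decidable-stable (P? a) (¬∃⟶∀¬ h a))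

module FiniteAutomata where

  open import Data.Nat using (_+_; _∸_; _≤_; s≤s)
  open import Data.Nat.Induction using (<-wellFounded)
  open import Induction.WellFounded using (Acc; acc)
  open import Data.List as L using (List; []; _∷_; foldl; length; take; drop; _++_)
  import Data.List.Properties as LP
  open import Data.Product.Function.NonDependent.Propositional using (_×-↔_)
  open import Function.Properties.Inverse using (↔-trans; ↔-sym)

  record Finite (A : Set) : Set where
    field
      size     : ℕ
      indexing : A ↔ Fin size

    enc : A → Fin size
    enc = Inverse.to indexing

    dec : Fin size → A
    dec = Inverse.from indexing

    dec-enc : ∀ a → dec (enc a) ≡ a
    dec-enc = Inverse.strictlyInverseʳ indexing

    enc-dec : ∀ k → enc (dec k) ≡ k
    enc-dec = Inverse.strictlyInverseˡ indexing

    enc-injective : ∀ {a b} → enc a ≡ enc b → a ≡ b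
    enc-injective {a} {b} e = trans (sym (dec-enc a)) (trans (cong dec e) (dec-enc b))

  open Finite public

  finite-Fin : ∀ k → Finite (Fin k)
  finite-Fin k = record { size = k ; indexing = ↔-id (Fin k) }

  finite-Bool : Finite Bool
  finite-Bool = record { size = 2 ; indexing = ↔-sym FP.2↔Bool }

  finite-× : ∀ {A B} → Finite A → Finite B → Finite (A × B)
  finite-× FA FB = record
    { size = size FA ℕ.* size FB ; indexing = ↔-trans (indexing FA ×-↔ indexing FB) (↔-sym FP.*↔×) }

  Vec-suc↔× : ∀ {A : Set} {k} → Vec A (suc k) ↔ (A × Vec A k)
  Vec-suc↔× = mk↔ₛ′ (λ v → V.head v , V.tail v) (λ (x , xs) → x ∷ xs) (λ _ → refl) (λ { (x ∷ xs) → refl })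

  finite-Vec : ∀ {A} → Finite A → ∀ k → Finite (Vec A k)
  finite-Vec FA zero = record
    { size = 1 ; indexing = mk↔ₛ′ (λ _ → zero) (λ _ → []) (λ { zero → refl }) (λ { [] → refl }) }
  finite-Vec FA (suc k) = record
    { size = size (finite-× FA (finite-Vec FA k))
    ; indexing = ↔-trans Vec-suc↔× (indexing (finite-× FA (finite-Vec FA k))) }

  anyFin : ∀ k → (Fin k → Bool) → Bool
  anyFin zero    p = false
  anyFin (suc k) p = p zero ∨ anyFin k (p ∘ suc)

  T-anyFin : ∀ {k} (p : Fin k → Bool) → T (anyFin k p) ⇔ ∃ λ i → T (p i)
  T-anyFin {zero}  p = mk⇔ (λ ()) (λ ())
  T-anyFin {suc k} p = ⇔.trans T-∨ (⇔.trans (⇔.refl ⊎-⇔ T-anyFin (p ∘ suc)) FP.⊎⇔∃)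

  record DFA (L : Set) : Set₁ where
    field
      Q     : Set
      finQ  : Finite Q
      q₀    : Q
      δ     : Q → L → Q
      final : Q → Bool
  open DFA public

  run : ∀ {L} (A : DFA L) → Q A → ∀ {n} → (Fin n → L) → Q A
  run A q {zero}  u = q
  run A q {suc n} u = run A (δ A q (u zero)) (u ∘ suc)

  accepts : ∀ {L} (A : DFA L) → ∀ {n} → (Fin n → L) → Bool
  accepts A u = final A (run A (q₀ A) u)

  run-cong : ∀ {L} (A : DFA L) q {n} {u v : Fin n → L} → (∀ i → u i ≡ v i) → run A q u ≡ run A q v
  run-cong A q {zero}  e = refl
  run-cong A q {suc n} e rewrite e zero = run-cong A _ (e ∘ suc)

  accepts-cong : ∀ {L} (A : DFA L) {n} {u v : Fin n → L} → (∀ i → u i ≡ v i) → accepts A u ≡ accepts A v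
  accepts-cong A e = cong (final A) (run-cong A (q₀ A) e)

  NonEmpty : ∀ {L} → DFA L → Set
  NonEmpty {L} A = ∃ λ n → Σ (Fin n → L) λ u → T (accepts A u)

  module Emptiness {L : Set} (FL : Finite L) (A : DFA L) where

    runList : Q A → List L → Q A
    runList = foldl (δ A)

    run-lookup : ∀ q (xs : List L) → run A q (L.lookup xs) ≡ runList q xs
    run-lookup q []       = refl
    run-lookup q (x ∷ xs) = run-lookup (δ A q x) xs

    run-tabulate : ∀ q {n} (u : Fin n → L) → runList q (L.tabulate u) ≡ run A q u
    run-tabulate q {zero}  u = refl
    run-tabulate q {suc n} u = run-tabulate (δ A q (u zero)) (u ∘ suc)

    AcceptsList : List L → Set
    AcceptsList xs = T (final A (runList (q₀ A) xs))

    -- There are more prefixes than states, so two of them reach the same state and the infix between them can be cut out.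
    shorter-accepted : ∀ xs → size (finQ A) ℕ.< suc (length xs) → AcceptsList xs →
                       ∃ λ ys → length ys ℕ.< length xs × AcceptsList ys
    shorter-accepted xs K<n h
      with i , j , i<j , same ← FP.pigeonhole K<n (λ i → enc (finQ A) (runList (q₀ A) (take (toℕ i) xs)))
      = take a xs ++ drop b xs , shorter , subst (T ∘ final A) (sym same-run) h
      where
      a = toℕ i
      b = toℕ j
      same-run : runList (q₀ A) (take a xs ++ drop b xs) ≡ runList (q₀ A) xs
      same-run = begin
        runList (q₀ A) (take a xs ++ drop b xs)     ≡⟨ LP.foldl-++ (δ A) (q₀ A) (take a xs) (drop b xs) ⟩
        runList (runList (q₀ A) (take a xs)) (drop b xs)
          ≡⟨ cong (λ q → runList q (drop b xs)) (enc-injective (finQ A) same) ⟩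
        runList (runList (q₀ A) (take b xs)) (drop b xs) ≡⟨ LP.foldl-++ (δ A) (q₀ A) (take b xs) (drop b xs) ⟨
        runList (q₀ A) (take b xs ++ drop b xs)     ≡⟨ cong (runList (q₀ A)) (LP.take++drop≡id b xs) ⟩
        runList (q₀ A) xs                           ∎
        where open ≡-Reasoning
      shorter : length (take a xs ++ drop b xs) ℕ.< length xs
      shorter = begin-strict
        length (take a xs ++ drop b xs)            ≡⟨ LP.length-++ (take a xs) ⟩
        length (take a xs) + length (drop b xs)    ≡⟨ cong₂ _+_ (LP.length-take a xs) (LP.length-drop b xs) ⟩
        (a ℕ.⊓ length xs) + (length xs ∸ b)        ≤⟨ ℕP.+-monoˡ-≤ _ (ℕP.m⊓n≤m a (length xs)) ⟩
        a + (length xs ∸ b)                        <⟨ ℕP.+-monoˡ-< _ i<j ⟩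
        b + (length xs ∸ b)                        ≡⟨ ℕP.m+[n∸m]≡n (ℕP.≤-pred (FP.toℕ<n j)) ⟩
        length xs                                  ∎
        where open ℕP.≤-Reasoning

    short-accepted : ∀ xs → Acc ℕ._<_ (length xs) → AcceptsList xs →
                     ∃ λ ys → length ys ≤ size (finQ A) × AcceptsList ys
    short-accepted xs (acc rec) h with length xs ℕ.≤? size (finQ A)
    ... | yes short = xs , short , h
    ... | no long with ys , shorter , h′ ← shorter-accepted xs (ℕP.m<n⇒m<1+n (ℕP.≰⇒> long)) h
      = short-accepted ys (rec shorter) h′

    acceptedWithin : Q A → ℕ → Bool
    acceptedWithin q zero    = final A q
    acceptedWithin q (suc k) = final A q ∨ anyFin (size FL) (λ l → acceptedWithin (δ A q (dec FL l)) k)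

    acceptedWithin-sound : ∀ q k → T (acceptedWithin q k) → ∃ λ xs → T (final A (runList q xs))
    acceptedWithin-sound q zero    t = [] , t
    acceptedWithin-sound q (suc k) t with to T-∨ t
    ... | inj₁ t′ = [] , t′
    ... | inj₂ t′ with l , t″ ← to (T-anyFin _) t′ with xs , h ← acceptedWithin-sound _ k t″
      = dec FL l ∷ xs , h

    acceptedWithin-complete : ∀ q k xs → length xs ≤ k → T (final A (runList q xs)) → T (acceptedWithin q k)
    acceptedWithin-complete q zero    []       le t = t
    acceptedWithin-complete q (suc k) []       le t = from T-∨ (inj₁ t)
    acceptedWithin-complete q (suc k) (x ∷ xs) (s≤s le) t =
      from T-∨ (inj₂ (from (T-anyFin _) (enc FL x , acceptedWithin-complete _ k xs le
        (subst (λ y → T (final A (runList (δ A q y) xs))) (sym (dec-enc FL x)) t))))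

    nonEmpty? : Dec (NonEmpty A)
    nonEmpty? with T? (acceptedWithin (q₀ A) (size (finQ A)))
    ... | yes t with xs , h ← acceptedWithin-sound (q₀ A) (size (finQ A)) t
      = yes (length xs , L.lookup xs , subst (T ∘ final A) (sym (run-lookup (q₀ A) xs)) h)
    ... | no ¬t = no λ (n , u , h) →
      let xs = L.tabulate u
          ys , short , h′ = short-accepted xs (<-wellFounded _) (subst (T ∘ final A) (sym (run-tabulate (q₀ A) u)) h)
      in ¬t (acceptedWithin-complete (q₀ A) _ ys short h′)

open FiniteAutomata

module AutomatonConstructions where

  open import Data.Fin using (_<_)
  open import Data.Bool.Properties using (∨-assoc; ∨-identityʳ)

  T-not : ∀ {b} → T (not b) ⇔ (¬ T b)
  T-not {false} = mk⇔ (λ _ ()) (λ _ → _)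
  T-not {true}  = mk⇔ (λ ()) (λ ¬t → ¬t _)

  T-implies : ∀ {a b} → T (not a ∨ b) ⇔ (T a → T b)
  T-implies {false} = mk⇔ (λ _ ()) (λ _ → _)
  T-implies {true}  = mk⇔ (λ t _ → t) (λ f → f _)

  T-∧₃ : ∀ {a b c} → T (a ∧ b ∧ c) ⇔ (T a × T b × T c)
  T-∧₃ = ⇔.trans T-∧ (⇔.refl ×-⇔ T-∧)

  T-⇔-≡ : ∀ {a b} → (T a ⇔ T b) → a ≡ b
  T-⇔-≡ {false} {false} _ = refl
  T-⇔-≡ {false} {true}  e = ⊥-elim (from e _)
  T-⇔-≡ {true}  {false} e = ⊥-elim (to e _)
  T-⇔-≡ {true}  {true}  _ = refl

  complement : ∀ {L} → DFA L → DFA L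
  complement A = record A { final = not ∘ final A }

  complement-run : ∀ {L} (A : DFA L) q {n} (u : Fin n → L) → run (complement A) q u ≡ run A q u
  complement-run A q {zero}  u = refl
  complement-run A q {suc n} u = complement-run A _ (u ∘ suc)

  complement-accepts : ∀ {L} (A : DFA L) {n} (u : Fin n → L) → T (accepts (complement A) u) ⇔ (¬ T (accepts A u))
  complement-accepts A u rewrite complement-run A (q₀ A) u = T-not

  complement-dual : ∀ {L L′ X : Set} (E : DFA L′ → DFA L) {n} (w : Fin n → L) (w′ : X → Fin n → L′) →
    (∀ A → T (accepts (E A) w) ⇔ ∃ λ x → T (accepts A (w′ x))) →
    ∀ A → T (accepts (complement (E (complement A))) w) ⇔ ∀ x → T (accepts A (w′ x))
  complement-dual E w w′ E-accepts A =
    ⇔.trans (complement-accepts (E (complement A)) w)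
   (⇔.trans (¬-cong-⇔ (⇔.trans (E-accepts (complement A)) (∃-cong-↔ (↔-id _) λ {x} → complement-accepts A (w′ x))))
            (⇔.sym (∀⇔¬∃¬ λ x → T? (accepts A (w′ x)))))

  product : ∀ {L} → (Bool → Bool → Bool) → DFA L → DFA L → DFA L
  product _⊕_ A B = record
    { Q = Q A × Q B ; finQ = finite-× (finQ A) (finQ B) ; q₀ = q₀ A , q₀ B
    ; δ = λ (p , q) l → δ A p l , δ B q l
    ; final = λ (p , q) → final A p ⊕ final B q }

  product-run : ∀ {L} _⊕_ (A B : DFA L) p q {n} (u : Fin n → L) →
                run (product _⊕_ A B) (p , q) u ≡ (run A p u , run B q u)
  product-run _⊕_ A B p q {zero}  u = refl
  product-run _⊕_ A B p q {suc n} u = product-run _⊕_ A B _ _ (u ∘ suc)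

  product-accepts : ∀ {L} _⊕_ (A B : DFA L) {n} (u : Fin n → L) →
                    accepts (product _⊕_ A B) u ≡ accepts A u ⊕ accepts B u
  product-accepts _⊕_ A B u rewrite product-run _⊕_ A B (q₀ A) (q₀ B) u = refl

  someLetter : ∀ {L} → (L → Bool) → DFA L
  someLetter P = record { Q = Bool ; finQ = finite-Bool ; q₀ = false ; δ = λ q l → q ∨ P l ; final = λ q → q }

  someLetter-run : ∀ {L} (P : L → Bool) q {n} (u : Fin n → L) → run (someLetter P) q u ≡ q ∨ anyFin n (P ∘ u)
  someLetter-run P q {zero}  u = sym (∨-identityʳ q)
  someLetter-run P q {suc n} u =
    trans (someLetter-run P (q ∨ P (u zero)) (u ∘ suc)) (∨-assoc q (P (u zero)) _)

  someLetter-accepts : ∀ {L} (P : L → Bool) {n} (u : Fin n → L) →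
                       T (accepts (someLetter P) u) ⇔ ∃ λ i → T (P (u i))
  someLetter-accepts P u rewrite someLetter-run P false u = T-anyFin (P ∘ u)

  module _ {L : Set} (FL : Finite L) (B : L → L → Bool) where
    private
      K = size FL

    markSeen : Vec Bool K → L → Vec Bool K
    markSeen S l = tabulate λ k → lookup S k ∨ ⌊ k F.≟ enc FL l ⌋

    -- The state records which letters have been read so far, and whether a pair has been found.
    somePair : DFA L
    somePair = record
      { Q = Vec Bool K × Bool ; finQ = finite-× (finite-Vec finite-Bool K) finite-Bool
      ; q₀ = V.replicate K false , false
      ; δ = λ (S , found) l → markSeen S l , (found ∨ anyFin K λ k → lookup S k ∧ B (dec FL k) l)
      ; final = proj₂ }

    PairFrom : ∀ {n} → Vec Bool K → Bool → (Fin n → L) → Set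
    PairFrom {n} S found u =
      T found
      ⊎ (∃₂ λ k j → T (lookup S k) × T (B (dec FL k) (u j)))
      ⊎ (∃₂ λ i j → i < j × T (B (u i) (u j)))

    somePair-run : ∀ S found {n} (u : Fin n → L) → T (proj₂ (run somePair (S , found) u)) ⇔ PairFrom S found u
    somePair-run S found {zero}  u = mk⇔ inj₁ λ { (inj₁ t) → t ; (inj₂ (inj₁ (_ , () , _))) ; (inj₂ (inj₂ (() , _))) }
    somePair-run S found {suc n} u = mk⇔ sound complete
      where
      u₀ = u zero
      S′ = markSeen S u₀
      found′ = found ∨ anyFin K λ k → lookup S k ∧ B (dec FL k) u₀
      ih = somePair-run S′ found′ (u ∘ suc)
      lookup-S′ : ∀ k → lookup S′ k ≡ (lookup S k ∨ ⌊ k F.≟ enc FL u₀ ⌋)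
      lookup-S′ k = VP.lookup∘tabulate _ k
      sound : T (proj₂ (run somePair (S′ , found′) (u ∘ suc))) → PairFrom S found u
      sound t with to ih t
      ... | inj₁ t₁ with to T-∨ t₁
      ...   | inj₁ t-found = inj₁ t-found
      ...   | inj₂ t-new with k , tk ← to (T-anyFin _) t-new =
        inj₂ (inj₁ (k , zero , to T-∧ tk))
      sound t | inj₂ (inj₂ (i , j , i<j , tB)) = inj₂ (inj₂ (suc i , suc j , ℕ.s<s i<j , tB))
      sound t | inj₂ (inj₁ (k , j , tk , tB)) with to T-∨ (subst T (lookup-S′ k) tk)
      ... | inj₁ tS = inj₂ (inj₁ (k , suc j , tS , tB))
      ... | inj₂ t≡ with refl ← toWitness t≡ =
        inj₂ (inj₂ (zero , suc j , ℕ.z<s , subst (λ z → T (B z (u (suc j)))) (dec-enc FL u₀) tB))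
      complete : PairFrom S found u → T (proj₂ (run somePair (S′ , found′) (u ∘ suc)))
      complete (inj₁ t) = from ih (inj₁ (from T-∨ (inj₁ t)))
      complete (inj₂ (inj₁ (k , zero , tS , tB))) =
        from ih (inj₁ (from T-∨ (inj₂ (from (T-anyFin _) (k , from T-∧ (tS , tB))))))
      complete (inj₂ (inj₁ (k , suc j , tS , tB))) =
        from ih (inj₂ (inj₁ (k , j , subst T (sym (lookup-S′ k)) (from T-∨ (inj₁ tS)) , tB)))
      complete (inj₂ (inj₂ (zero , suc j , _ , tB))) =
        from ih (inj₂ (inj₁ (enc FL u₀ , j ,
          subst T (sym (lookup-S′ (enc FL u₀))) (from (T-∨ {lookup S (enc FL u₀)}) (inj₂ (fromWitness refl))) ,
          subst (λ z → T (B z (u (suc j)))) (sym (dec-enc FL u₀)) tB)))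
      complete (inj₂ (inj₂ (suc i , suc j , ℕ.s<s i<j , tB))) = from ih (inj₂ (inj₂ (i , j , i<j , tB)))

    somePair-accepts : ∀ {n} (u : Fin n → L) →
                       T (accepts somePair u) ⇔ ∃₂ λ i j → i < j × T (B (u i) (u j))
    somePair-accepts u = mk⇔ (initial ∘ to (somePair-run _ _ u)) (from (somePair-run _ _ u) ∘ inj₂ ∘ inj₂)
      where
      initial : PairFrom (V.replicate K false) false u → ∃₂ λ i j → i < j × T (B (u i) (u j))
      initial (inj₂ (inj₁ (k , _ , tS , _))) = ⊥-elim (subst T (VP.lookup-replicate k false) tS)
      initial (inj₂ (inj₂ p)) = p

  anyBool : (Bool → Bool) → Bool
  anyBool p = p false ∨ p true

  T-anyBool : ∀ (p : Bool → Bool) → T (anyBool p) ⇔ ∃ λ b → T (p b)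
  T-anyBool p = mk⇔ sound complete
    where
    sound : T (anyBool p) → ∃ λ b → T (p b)
    sound t with to T-∨ t
    ... | inj₁ t′ = false , t′
    ... | inj₂ t′ = true , t′
    complete : ∃ (λ b → T (p b)) → T (anyBool p)
    complete (false , t) = from T-∨ (inj₁ t)
    complete (true  , t) = from (T-∨ {p false}) (inj₂ t)

  marked : ∀ {L L′ : Set} → (Bool → L → L′) → ∀ {n} → (Fin n → Bool) → (Fin n → L) → Fin n → L′
  marked mark b u i = mark (b i) (u i)

  -- Existential quantification over an extra Boolean track, by the subset construction.
  module _ {L L′ : Set} (mark : Bool → L → L′) (A : DFA L′) where
    private
      FQ = finQ A
      K = size FQ

    movesTo : L → Fin K → Fin K → Bool → Bool
    movesTo l k k′ b = ⌊ enc FQ (δ A (dec FQ k′) (mark b l)) F.≟ k ⌋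

    successors : Vec Bool K → L → Fin K → Bool
    successors S l k = anyFin K λ k′ → lookup S k′ ∧ anyBool (movesTo l k k′)

    isInitial : Fin K → Bool
    isInitial k = ⌊ enc FQ (q₀ A) F.≟ k ⌋

    stepSet : Vec Bool K → L → Vec Bool K
    stepSet S l = tabulate (successors S l)

    project : DFA L
    project = record
      { Q = Vec Bool K ; finQ = finite-Vec finite-Bool K
      ; q₀ = tabulate isInitial
      ; δ = stepSet
      ; final = λ S → anyFin K λ k → lookup S k ∧ final A (dec FQ k) }

    stepSet-lookup : ∀ S l k → T (lookup (stepSet S l) k) ⇔
                     ∃ λ k′ → T (lookup S k′) × ∃ λ b → enc FQ (δ A (dec FQ k′) (mark b l)) ≡ k
    stepSet-lookup S l k = mk⇔ sound complete
      where
      MovesInto = ∃ λ k′ → T (lookup S k′) × ∃ λ b → enc FQ (δ A (dec FQ k′) (mark b l)) ≡ k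
      sound : T (lookup (stepSet S l) k) → MovesInto
      sound t with k′ , t′ ← to (T-anyFin _) (subst T (VP.lookup∘tabulate (successors S l) k) t)
                 with tS , tb ← to (T-∧ {lookup S k′}) t′
                 with b , t≡ ← to (T-anyBool (movesTo l k k′)) tb = k′ , tS , b , toWitness t≡
      complete : MovesInto → T (lookup (stepSet S l) k)
      complete (k′ , tS , b , e) = subst T (sym (VP.lookup∘tabulate (successors S l) k))
        (from (T-anyFin _) (k′ , from T-∧ (tS , from (T-anyBool (movesTo l k k′)) (b , fromWitness e))))

    ReachableFrom : ∀ {n} → Vec Bool K → (Fin n → L) → Fin K → Set
    ReachableFrom {n} S u k =
      ∃ λ k′ → T (lookup S k′) × Σ (Fin n → Bool) λ b → enc FQ (run A (dec FQ k′) (marked mark b u)) ≡ k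

    project-run : ∀ S {n} (u : Fin n → L) k → T (lookup (run project S u) k) ⇔ ReachableFrom S u k
    project-run S {zero}  u k = mk⇔ (λ t → k , t , (λ ()) , enc-dec FQ k)
      λ (k′ , t , _ , e) → subst (T ∘ lookup S) (trans (sym (enc-dec FQ k′)) e) t
    project-run S {suc n} u k = mk⇔ sound complete
      where
      u₀ = u zero
      ih = project-run (stepSet S u₀) (u ∘ suc) k
      sound : T (lookup (run project S u) k) → ReachableFrom S u k
      sound t with k″ , t″ , b , e ← to ih t
              with k′ , tS , b₀ , refl ← to (stepSet-lookup S u₀ k″) t″ =
        k′ , tS , (λ { zero → b₀ ; (suc i) → b i }) ,
        trans (cong (λ q → enc FQ (run A q (marked mark b (u ∘ suc)))) (sym (dec-enc FQ _))) e
      complete : ReachableFrom S u k → T (lookup (run project S u) k)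
      complete (k′ , tS , b , e) = from ih
        (enc FQ (δ A (dec FQ k′) (mark (b zero) u₀)) ,
         from (stepSet-lookup S u₀ _) (k′ , tS , b zero , refl) ,
         b ∘ suc , trans (cong (λ q → enc FQ (run A q (marked mark (b ∘ suc) (u ∘ suc)))) (dec-enc FQ _)) e)

    project-accepts : ∀ {n} (u : Fin n → L) →
                      T (accepts project u) ⇔ Σ (Fin n → Bool) λ b → T (accepts A (marked mark b u))
    project-accepts u = mk⇔ sound complete
      where
      S₀ = q₀ project
      sound : T (accepts project u) → Σ (Fin _ → Bool) λ b → T (accepts A (marked mark b u))
      sound t with k , tk ← to (T-anyFin _) t
              with tS , t-final ← to T-∧ tk
              with k′ , t₀ , b , e ← to (project-run S₀ u k) tS = b , subst (T ∘ final A) reached t-final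
        where
        start : dec FQ k′ ≡ q₀ A
        start = trans (cong (dec FQ) (sym (toWitness (subst T (VP.lookup∘tabulate isInitial k′) t₀)))) (dec-enc FQ _)
        reached : dec FQ k ≡ run A (q₀ A) (marked mark b u)
        reached = trans (trans (cong (dec FQ) (sym e)) (dec-enc FQ _)) (cong (λ q → run A q (marked mark b u)) start)
      complete : Σ (Fin _ → Bool) (λ b → T (accepts A (marked mark b u))) → T (accepts project u)
      complete (b , t) = from (T-anyFin _) (k , from T-∧ (reach , subst (T ∘ final A) (sym (dec-enc FQ _)) t))
        where
        k = enc FQ (run A (q₀ A) (marked mark b u))
        reach = from (project-run S₀ u k)
          (enc FQ (q₀ A) , subst T (sym (VP.lookup∘tabulate isInitial _)) (fromWitness refl) , b ,
           cong (λ q → enc FQ (run A q (marked mark b u))) (dec-enc FQ (q₀ A)))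

  module _ {L : Set} (A B : DFA L) {n} (u : Fin n → L) where

    product-∧ : T (accepts (product _∧_ A B) u) ⇔ (T (accepts A u) × T (accepts B u))
    product-∧ rewrite product-accepts _∧_ A B u = T-∧

    product-∨ : T (accepts (product _∨_ A B) u) ⇔ (T (accepts A u) ⊎ T (accepts B u))
    product-∨ rewrite product-accepts _∨_ A B u = T-∨

    product-implies : T (accepts (product (λ a b → not a ∨ b) A B) u) ⇔ (T (accepts A u) → T (accepts B u))
    product-implies rewrite product-accepts (λ a b → not a ∨ b) A B u = T-implies

  module _ {L : Set} (FL : Finite L) (P : L → Bool) where

    bothMarked : L → L → Bool
    bothMarked a b = P a ∧ P b

    exactlyOne : DFA L
    exactlyOne = product _∧_ (someLetter P) (complement (somePair FL bothMarked))

    exactlyOne-accepts : ∀ {n} (u : Fin n → L) → T (accepts exactlyOne u) ⇔ ∃ λ a → ∀ i → T (P (u i)) ⇔ i ≡ a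
    exactlyOne-accepts u = mk⇔ sound complete
      where
      Pairs = ∃₂ λ i j → i < j × T (bothMarked (u i) (u j))
      sound : T (accepts exactlyOne u) → ∃ λ a → ∀ i → T (P (u i)) ⇔ i ≡ a
      sound t with some , noPair ← to (product-∧ (someLetter P) (complement (somePair FL bothMarked)) u) t
              with a , ta ← to (someLetter-accepts P u) some =
        a , λ i → mk⇔ (unique i) (λ { refl → ta })
        where
        pair : Pairs → _
        pair = to (complement-accepts (somePair FL bothMarked) u) noPair ∘ from (somePair-accepts FL bothMarked u)
        unique : ∀ i → T (P (u i)) → i ≡ a
        unique i ti with FP.<-cmp i a
        ... | tri< i<a _ _ = ⊥-elim (pair (i , a , i<a , from T-∧ (ti , ta)))
        ... | tri≈ _ i≡a _ = i≡a
        ... | tri> _ _ a<i = ⊥-elim (pair (a , i , a<i , from T-∧ (ta , ti)))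
      complete : (∃ λ a → ∀ i → T (P (u i)) ⇔ i ≡ a) → T (accepts exactlyOne u)
      complete (a , only) = from (product-∧ (someLetter P) (complement (somePair FL bothMarked)) u)
        (from (someLetter-accepts P u) (a , from (only a) refl) , from (complement-accepts (somePair FL bothMarked) u) noPair)
        where
        noPair : ¬ T (accepts (somePair FL bothMarked) u)
        noPair t with i , j , i<j , tij ← to (somePair-accepts FL bothMarked u) t with ti , tj ← to T-∧ tij
          with refl ← to (only i) ti with refl ← to (only j) tj = FP.<-irrefl refl i<j

open AutomatonConstructions

module PermutationIsomorphisms where

  record _≅_ (π π′ : Perm) : Set where
    field
      points : Fin (Perm.size π) ↔ Fin (Perm.size π′)
    open Inverse points public using ()
      renaming (to to map; from to map⁻¹; strictlyInverseˡ to map-map⁻¹; strictlyInverseʳ to map⁻¹-map)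
    field
      <₁-cong : ∀ i j → Perm._<₁_ π i j ⇔ Perm._<₁_ π′ (map i) (map j)
      <₂-cong : ∀ i j → Perm._<₂_ π i j ⇔ Perm._<₂_ π′ (map i) (map j)

  ≅-refl : ∀ {π} → π ≅ π
  ≅-refl = record
    { points = mk↔ₛ′ (λ i → i) (λ i → i) (λ _ → refl) (λ _ → refl)
    ; <₁-cong = λ _ _ → mk⇔ (λ p → p) (λ p → p) ; <₂-cong = λ _ _ → mk⇔ (λ p → p) (λ p → p) }

  module _ {π π′ : Perm} (I : π ≅ π′) where
    open _≅_ I

    subsets : Subset (Perm.size π) ↔ Subset (Perm.size π′)
    subsets = mk↔ₛ′ (λ A → tabulate (lookup A ∘ map⁻¹)) (λ A′ → tabulate (lookup A′ ∘ map))
      (λ A′ → trans (VP.tabulate-cong λ j → trans (VP.lookup∘tabulate _ (map⁻¹ j)) (cong (lookup A′) (map-map⁻¹ j)))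
                    (VP.tabulate∘lookup A′))
      (λ A → trans (VP.tabulate-cong λ i → trans (VP.lookup∘tabulate _ (map i)) (cong (lookup A) (map⁻¹-map i)))
                   (VP.tabulate∘lookup A))

    ElementsRelated : ∀ {e} → (Fin e → Fin (Perm.size π)) → (Fin e → Fin (Perm.size π′)) → Set
    ElementsRelated ρ ρ′ = ∀ x → ρ′ x ≡ map (ρ x)

    SetsRelated : ∀ {s} → (Fin s → Subset (Perm.size π)) → (Fin s → Subset (Perm.size π′)) → Set
    SetsRelated σ σ′ = ∀ X i → lookup (σ X) i ≡ lookup (σ′ X) (map i)

    extend-elements : ∀ {e} {ρ ρ′} a → ElementsRelated {e} ρ ρ′ → ElementsRelated (extend a ρ) (extend (map a) ρ′)
    extend-elements a related zero    = refl
    extend-elements a related (suc x) = related x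

    extend-sets : ∀ {s} {σ σ′} A → SetsRelated {s} σ σ′ →
                  SetsRelated (extend A σ) (extend (Inverse.to subsets A) σ′)
    extend-sets A related zero    i = trans (cong (lookup A) (sym (map⁻¹-map i))) (sym (VP.lookup∘tabulate _ (map i)))
    extend-sets A related (suc X) i = related X i

    Sat-≅ : ∀ {e s} (φ : Formula e s) {ρ ρ′ σ σ′} → ElementsRelated ρ ρ′ → SetsRelated σ σ′ →
            Sat π φ ρ σ ⇔ Sat π′ φ ρ′ σ′
    Sat-≅ (lt₁ x y) {ρ} hρ hσ rewrite hρ x | hρ y = <₁-cong (ρ x) (ρ y)
    Sat-≅ (lt₂ x y) {ρ} hρ hσ rewrite hρ x | hρ y = <₂-cong (ρ x) (ρ y)
    Sat-≅ (eq x y)  {ρ} hρ hσ rewrite hρ x | hρ y =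
      mk⇔ (cong map) (λ e → trans (sym (map⁻¹-map _)) (trans (cong map⁻¹ e) (map⁻¹-map _)))
    Sat-≅ (mem x X) {ρ} hρ hσ rewrite hρ x =
      mk⇔ (λ m → VP.lookup⇒[]= _ _ (trans (sym (hσ X (ρ x))) (VP.[]=⇒lookup m)))
          (λ m → VP.lookup⇒[]= _ _ (trans (hσ X (ρ x)) (VP.[]=⇒lookup m)))
    Sat-≅ ff        hρ hσ = mk⇔ (λ ()) (λ ())
    Sat-≅ (neg φ)   hρ hσ = ¬-cong-⇔ (Sat-≅ φ hρ hσ)
    Sat-≅ (and φ ψ) hρ hσ = Sat-≅ φ hρ hσ ×-⇔ Sat-≅ ψ hρ hσ
    Sat-≅ (or φ ψ)  hρ hσ = Sat-≅ φ hρ hσ ⊎-⇔ Sat-≅ ψ hρ hσ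
    Sat-≅ (imp φ ψ) hρ hσ = →-cong-⇔ (Sat-≅ φ hρ hσ) (Sat-≅ ψ hρ hσ)
    Sat-≅ (exE φ)   hρ hσ = ∃-cong-↔ points λ {a} → Sat-≅ φ (extend-elements a hρ) hσ
    Sat-≅ (allE φ)  hρ hσ = ∀-cong-↔ points λ {a} → Sat-≅ φ (extend-elements a hρ) hσ
    Sat-≅ (exS φ)   hρ hσ = ∃-cong-↔ subsets λ {A} → Sat-≅ φ hρ (extend-sets A hσ)
    Sat-≅ (allS φ)  hρ hσ = ∀-cong-↔ subsets λ {A} → Sat-≅ φ hρ (extend-sets A hσ)

    ⊨-≅ : ∀ θ → π ⊨ θ ⇔ π′ ⊨ θ
    ⊨-≅ θ = Sat-≅ θ (λ ()) (λ ())

  ⊨⇔Sat : ∀ π θ {ρ σ} → π ⊨ θ ⇔ Sat π θ ρ σ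
  ⊨⇔Sat π θ = Sat-≅ ≅-refl θ (λ ()) (λ ())

open PermutationIsomorphisms

module WordAutomata where

  open import Data.Fin using (_<_)
  open import Relation.Nullary.Decidable using (_×-dec_; _⊎-dec_)

  LineOrder : ∀ {k} → (Fin k → Sign) → Fin k → Fin k → ∀ {n} → Fin n → Fin n → Set
  LineOrder sg c c′ i j = c < c′ ⊎ (c ≡ c′ × Oriented (sg c) _<_ i j)

  Oriented-< : ∀ s {n} {i j : Fin n} → i < j → Oriented s _<_ i j ⇔ s ≡ s+
  Oriented-< s+ i<j = mk⇔ (λ _ → refl) (λ _ → i<j)
  Oriented-< s- i<j = mk⇔ (λ j<i → ⊥-elim (FP.<-asym i<j j<i)) (λ ())

  Oriented-> : ∀ s {n} {i j : Fin n} → i < j → Oriented s _<_ j i ⇔ s ≡ s-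
  Oriented-> s+ i<j = mk⇔ (λ j<i → ⊥-elim (FP.<-asym i<j j<i)) (λ ())
  Oriented-> s- i<j = mk⇔ (λ _ → refl) (λ _ → i<j)

  LineOrder-irrefl : ∀ {k} (sg : Fin k → Sign) c {n} (i : Fin n) → ¬ LineOrder sg c c i i
  LineOrder-irrefl sg c i (inj₁ c<c)           = FP.<-irrefl refl c<c
  LineOrder-irrefl sg c i (inj₂ (_ , i<i)) with sg c
  ... | s+ = FP.<-irrefl refl i<i
  ... | s- = FP.<-irrefl refl i<i

  LineOrder-total : ∀ {k} (sg : Fin k → Sign) c c′ {n} {i j : Fin n} → i ≢ j →
                    LineOrder sg c c′ i j ⊎ LineOrder sg c′ c j i
  LineOrder-total sg c c′ {i = i} {j} i≢j with FP.<-cmp c c′ | FP.<-cmp i j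
  ... | tri< c<c′ _ _ | _ = inj₁ (inj₁ c<c′)
  ... | tri> _ _ c′<c | _ = inj₂ (inj₁ c′<c)
  ... | tri≈ _ refl _ | tri≈ _ i≡j _ = ⊥-elim (i≢j i≡j)
  ... | tri≈ _ refl _ | tri< i<j _ _ with sg c
  ...   | s+ = inj₁ (inj₂ (refl , i<j))
  ...   | s- = inj₂ (inj₂ (refl , i<j))
  LineOrder-total sg c c′ i≢j | tri≈ _ refl _ | tri> _ _ j<i with sg c
  ...   | s+ = inj₂ (inj₂ (refl , j<i))
  ...   | s- = inj₁ (inj₂ (refl , j<i))

  _≟ˢ_ : (s t : Sign) → Dec (s ≡ t)
  s+ ≟ˢ s+ = yes refl
  s- ≟ˢ s- = yes refl
  s+ ≟ˢ s- = no λ ()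
  s- ≟ˢ s+ = no λ ()

  LineBefore : ∀ {k} → (Fin k → Sign) → Sign → Fin k → Fin k → Set
  LineBefore sg t c c′ = c < c′ ⊎ (c ≡ c′ × sg c ≡ t)

  lineBefore? : ∀ {k} (sg : Fin k → Sign) t c c′ → Dec (LineBefore sg t c c′)
  lineBefore? sg t c c′ = (c F.<? c′) ⊎-dec ((c F.≟ c′) ×-dec (sg c ≟ˢ t))

  module Words {w h : ℕ} (cs : Fin w → Sign) (rs : Fin h → Sign) where

    Cell : Set
    Cell = Fin w × Fin h

    column : Cell → Fin w
    column = proj₁

    row : Cell → Fin h
    row = proj₂

    -- The points of a word f are placed along the segments of the cells f i in the order of the word;
    -- within a column (row) this order appears reversed when the column (row) sign is negative.
    wordPerm : ∀ {n} → (Fin n → Cell) → Perm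
    wordPerm {n} f = record
      { size = n
      ; _<₁_ = λ i j → LineOrder cs (column (f i)) (column (f j)) i j
      ; _<₂_ = λ i j → LineOrder rs (row (f i)) (row (f j)) i j }

    -- A letter records the cell of a point and which element and set variables it belongs to.
    Letter : ℕ → ℕ → Set
    Letter e s = Cell × Vec Bool e × Vec Bool s

    finite-Letter : ∀ e s → Finite (Letter e s)
    finite-Letter e s =
      finite-× (finite-× (finite-Fin w) (finite-Fin h)) (finite-× (finite-Vec finite-Bool e) (finite-Vec finite-Bool s))

    annotate : ∀ {n e s} → (Fin n → Cell) → (Fin e → Fin n) → (Fin s → Subset n) → Fin n → Letter e s
    annotate f ρ σ i = f i , tabulate (λ x → ⌊ ρ x F.≟ i ⌋) , tabulate (λ X → lookup (σ X) i)

    isElement : ∀ {e s} → Fin e → Letter e s → Bool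
    isElement x (_ , xs , _) = lookup xs x

    isMember : ∀ {e s} → Fin s → Letter e s → Bool
    isMember X (_ , _ , Xs) = lookup Xs X

    isElement-annotate : ∀ {n e s} (f : Fin n → Cell) ρ (σ : Fin s → Subset n) (x : Fin e) i →
                         T (isElement x (annotate f ρ σ i)) ⇔ ρ x ≡ i
    isElement-annotate f ρ σ x i rewrite VP.lookup∘tabulate (λ x → ⌊ ρ x F.≟ i ⌋) x = mk⇔ toWitness fromWitness

    isMember-annotate : ∀ {n e s} (f : Fin n → Cell) (ρ : Fin e → Fin n) σ (X : Fin s) i →
                        T (isMember X (annotate f ρ σ i)) ⇔ i ∈ σ X
    isMember-annotate f ρ σ X i rewrite VP.lookup∘tabulate (λ X → lookup (σ X) i) X =
      mk⇔ (VP.lookup⇒[]= i (σ X) ∘ to T-≡) (from T-≡ ∘ VP.[]=⇒lookup)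

    cell : ∀ {e s} → Letter e s → Cell
    cell = proj₁

    -- Two positions i < j realise the atom x <ₗ y either as (x , y) or as (y , x).
    module _ {k} (line : Cell → Fin k) (sg : Fin k → Sign) {e s : ℕ} (x y : Fin e) where

      before : Sign → Letter e s → Letter e s → Bool
      before t a b = ⌊ lineBefore? sg t (line (cell a)) (line (cell b)) ⌋

      orderedPair : Letter e s → Letter e s → Bool
      orderedPair a b = (isElement x a ∧ isElement y b ∧ before s+ a b) ∨
                        (isElement y a ∧ isElement x b ∧ before s- b a)

      lineOrderAutomaton : DFA (Letter e s)
      lineOrderAutomaton = somePair (finite-Letter e s) orderedPair

      lineOrderAutomaton-accepts : ∀ {n} (f : Fin n → Cell) ρ σ →
        T (accepts lineOrderAutomaton (annotate f ρ σ)) ⇔ LineOrder sg (line (f (ρ x))) (line (f (ρ y))) (ρ x) (ρ y)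
      lineOrderAutomaton-accepts f ρ σ = ⇔.trans (somePair-accepts (finite-Letter e s) orderedPair W) (mk⇔ sound complete)
        where
        W = annotate f ρ σ
        l = line ∘ f
        forward : ∀ {i j} → i < j → LineOrder sg (l i) (l j) i j ⇔ LineBefore sg s+ (l i) (l j)
        forward i<j = ⇔.refl ⊎-⇔ (⇔.refl ×-⇔ Oriented-< _ i<j)
        backward : ∀ {i j} → i < j → LineOrder sg (l j) (l i) j i ⇔ LineBefore sg s- (l j) (l i)
        backward i<j = ⇔.refl ⊎-⇔ (⇔.refl ×-⇔ Oriented-> _ i<j)
        at : ∀ z i → T (isElement z (W i)) ⇔ ρ z ≡ i
        at z i = isElement-annotate f ρ σ z i
        pair : ∀ z z′ t {i j} c c′ → T (isElement z (W i) ∧ isElement z′ (W j) ∧ ⌊ lineBefore? sg t c c′ ⌋) ⇔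
                                      (ρ z ≡ i × ρ z′ ≡ j × LineBefore sg t c c′)
        pair z z′ t c c′ = ⇔.trans T-∧₃ (at z _ ×-⇔ at z′ _ ×-⇔ mk⇔ toWitness fromWitness)
        sound : (∃₂ λ i j → i < j × T (orderedPair (W i) (W j))) → LineOrder sg (l (ρ x)) (l (ρ y)) (ρ x) (ρ y)
        sound (i , j , i<j , t) with to (T-∨ {isElement x (W i) ∧ _}) t
        ... | inj₁ t′ with refl , refl , b ← to (pair x y s+ (l i) (l j)) t′ = from (forward i<j) b
        ... | inj₂ t′ with refl , refl , b ← to (pair y x s- (l j) (l i)) t′ = from (backward i<j) b
        complete : LineOrder sg (l (ρ x)) (l (ρ y)) (ρ x) (ρ y) → ∃₂ λ i j → i < j × T (orderedPair (W i) (W j))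
        complete o with FP.<-cmp (ρ x) (ρ y)
        ... | tri< x<y _ _ = ρ x , ρ y , x<y ,
          from T-∨ (inj₁ (from (pair x y s+ _ _) (refl , refl , to (forward x<y) o)))
        ... | tri≈ _ x≡y _ = ⊥-elim (LineOrder-irrefl sg _ (ρ y) (subst (λ z → LineOrder sg (l z) (l (ρ y)) z (ρ y)) x≡y o))
        ... | tri> _ _ y<x = ρ y , ρ x , y<x ,
          from (T-∨ {isElement x (W (ρ y)) ∧ _}) (inj₂ (from (pair y x s- _ _) (refl , refl , to (backward y<x) o)))

    markElement : ∀ {e s} → Bool → Letter e s → Letter (suc e) s
    markElement b (c , xs , Xs) = c , b ∷ xs , Xs

    markSet : ∀ {e s} → Bool → Letter e s → Letter e (suc s)
    markSet b (c , xs , Xs) = c , xs , b ∷ Xs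

    markElement-annotate : ∀ {n e s} (f : Fin n → Cell) (ρ : Fin e → Fin n) (σ : Fin s → Subset n) b a →
      (∀ i → T (b i) ⇔ i ≡ a) → ∀ i → marked markElement b (annotate f ρ σ) i ≡ annotate f (extend a ρ) σ i
    markElement-annotate f ρ σ b a marks-a i =
      cong (λ z → f i , z ∷ _ , _) (T-⇔-≡ (⇔.trans (marks-a i) (mk⇔ (fromWitness ∘ sym) (sym ∘ toWitness))))

    module _ {e s : ℕ} where

      existsElement : DFA (Letter (suc e) s) → DFA (Letter e s)
      existsElement A = project markElement (product _∧_ A (exactlyOne (finite-Letter (suc e) s) (isElement zero)))

      existsElement-accepts : ∀ (A : DFA (Letter (suc e) s)) {n} (f : Fin n → Cell) ρ σ →
        T (accepts (existsElement A) (annotate f ρ σ)) ⇔ ∃ λ a → T (accepts A (annotate f (extend a ρ) σ))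
      existsElement-accepts A {n} f ρ σ =
        ⇔.trans (project-accepts markElement (product _∧_ A Once) W) (mk⇔ sound complete)
        where
        W = annotate f ρ σ
        Once = exactlyOne (finite-Letter (suc e) s) (isElement zero)
        sound : (Σ (Fin n → Bool) λ b → T (accepts (product _∧_ A Once) (marked markElement b W))) →
                ∃ λ a → T (accepts A (annotate f (extend a ρ) σ))
        sound (b , t) with tA , tOnce ← to (product-∧ A Once (marked markElement b W)) t
                      with a , only ← to (exactlyOne-accepts (finite-Letter (suc e) s) (isElement zero) _) tOnce =
          a , subst T (accepts-cong A (markElement-annotate f ρ σ b a only)) tA
        complete : (∃ λ a → T (accepts A (annotate f (extend a ρ) σ))) →
                   Σ (Fin n → Bool) λ b → T (accepts (product _∧_ A Once) (marked markElement b W))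
        complete (a , t) = indicator ,
          from (product-∧ A Once (marked markElement indicator W))
            (t , from (exactlyOne-accepts (finite-Letter (suc e) s) (isElement zero) (marked markElement indicator W))
                      (a , λ i → mk⇔ (sym ∘ toWitness) (fromWitness ∘ sym)))
          where
          indicator = λ i → ⌊ a F.≟ i ⌋

      forallElement : DFA (Letter (suc e) s) → DFA (Letter e s)
      forallElement A = complement (existsElement (complement A))

      forallElement-accepts : ∀ (A : DFA (Letter (suc e) s)) {n} (f : Fin n → Cell) ρ σ →
        T (accepts (forallElement A) (annotate f ρ σ)) ⇔ ∀ a → T (accepts A (annotate f (extend a ρ) σ))
      forallElement-accepts A f ρ σ =
        complement-dual existsElement (annotate f ρ σ) (λ a → annotate f (extend a ρ) σ) (λ A → existsElement-accepts A f ρ σ) A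

      existsSet : DFA (Letter e (suc s)) → DFA (Letter e s)
      existsSet A = project markSet A

      existsSet-accepts : ∀ (A : DFA (Letter e (suc s))) {n} (f : Fin n → Cell) ρ σ →
        T (accepts (existsSet A) (annotate f ρ σ)) ⇔ ∃ λ S → T (accepts A (annotate f ρ (extend S σ)))
      existsSet-accepts A f ρ σ = ⇔.trans (project-accepts markSet A _) (mk⇔
        (λ (b , t) → tabulate b , subst T (accepts-cong A λ i → cong (λ z → f i , _ , z ∷ _) (sym (VP.lookup∘tabulate b i))) t)
        (λ (S , t) → lookup S , t))

      forallSet : DFA (Letter e (suc s)) → DFA (Letter e s)
      forallSet A = complement (existsSet (complement A))

      forallSet-accepts : ∀ (A : DFA (Letter e (suc s))) {n} (f : Fin n → Cell) ρ σ →
        T (accepts (forallSet A) (annotate f ρ σ)) ⇔ ∀ S → T (accepts A (annotate f ρ (extend S σ)))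
      forallSet-accepts A f ρ σ =
        complement-dual existsSet (annotate f ρ σ) (λ S → annotate f ρ (extend S σ)) (λ A → existsSet-accepts A f ρ σ) A

    automaton : ∀ {e s} → Formula e s → DFA (Letter e s)
    automaton (lt₁ x y) = lineOrderAutomaton column cs x y
    automaton (lt₂ x y) = lineOrderAutomaton row rs x y
    automaton (eq x y)  = someLetter λ l → isElement x l ∧ isElement y l
    automaton (mem x X) = someLetter λ l → isElement x l ∧ isMember X l
    automaton ff        = someLetter λ _ → false
    automaton (neg φ)   = complement (automaton φ)
    automaton (and φ ψ) = product _∧_ (automaton φ) (automaton ψ)
    automaton (or φ ψ)  = product _∨_ (automaton φ) (automaton ψ)
    automaton (imp φ ψ) = product (λ a b → not a ∨ b) (automaton φ) (automaton ψ)
    automaton (exE φ)   = existsElement (automaton φ)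
    automaton (allE φ)  = forallElement (automaton φ)
    automaton (exS φ)   = existsSet (automaton φ)
    automaton (allS φ)  = forallSet (automaton φ)

    automaton-correct : ∀ {e s} (φ : Formula e s) {n} (f : Fin n → Cell) ρ σ →
                        T (accepts (automaton φ) (annotate f ρ σ)) ⇔ Sat (wordPerm f) φ ρ σ
    automaton-correct (lt₁ x y) f ρ σ = lineOrderAutomaton-accepts column cs x y f ρ σ
    automaton-correct (lt₂ x y) f ρ σ = lineOrderAutomaton-accepts row rs x y f ρ σ
    automaton-correct (eq x y)  f ρ σ = ⇔.trans (someLetter-accepts _ (annotate f ρ σ)) (mk⇔
      (λ (i , t) → let tx , ty = to T-∧ t in trans (to (at x i) tx) (sym (to (at y i) ty)))
      (λ x≡y → ρ x , from T-∧ (from (at x _) refl , from (at y _) (sym x≡y))))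
      where at = isElement-annotate f ρ σ
    automaton-correct (mem x X) f ρ σ = ⇔.trans (someLetter-accepts _ (annotate f ρ σ)) (mk⇔
      (λ (i , t) → let tx , tX = to T-∧ t in subst (_∈ σ X) (sym (to (at x i) tx)) (to (isMember-annotate f ρ σ X i) tX))
      (λ x∈X → ρ x , from T-∧ (from (at x _) refl , from (isMember-annotate f ρ σ X _) x∈X)))
      where at = isElement-annotate f ρ σ
    automaton-correct ff        f ρ σ = ⇔.trans (someLetter-accepts _ (annotate f ρ σ)) (mk⇔ (λ ()) (λ ()))
    automaton-correct (neg φ)   f ρ σ = ⇔.trans (complement-accepts (automaton φ) (annotate f ρ σ))
                                                (¬-cong-⇔ (automaton-correct φ f ρ σ))
    automaton-correct (and φ ψ) f ρ σ = ⇔.trans (product-∧ (automaton φ) (automaton ψ) (annotate f ρ σ))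
                                                (automaton-correct φ f ρ σ ×-⇔ automaton-correct ψ f ρ σ)
    automaton-correct (or φ ψ)  f ρ σ = ⇔.trans (product-∨ (automaton φ) (automaton ψ) (annotate f ρ σ))
                                                (automaton-correct φ f ρ σ ⊎-⇔ automaton-correct ψ f ρ σ)
    automaton-correct (imp φ ψ) f ρ σ = ⇔.trans (product-implies (automaton φ) (automaton ψ) (annotate f ρ σ))
                                                (→-cong-⇔ (automaton-correct φ f ρ σ) (automaton-correct ψ f ρ σ))
    automaton-correct (exE φ)   f ρ σ = ⇔.trans (existsElement-accepts (automaton φ) f ρ σ)
                                                (∃-cong-↔ (↔-id _) λ {a} → automaton-correct φ f (extend a ρ) σ)
    automaton-correct (allE φ)  f ρ σ = ⇔.trans (forallElement-accepts (automaton φ) f ρ σ)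
                                                (∀-cong-↔ (↔-id _) λ {a} → automaton-correct φ f (extend a ρ) σ)
    automaton-correct (exS φ)   f ρ σ = ⇔.trans (existsSet-accepts (automaton φ) f ρ σ)
                                                (∃-cong-↔ (↔-id _) λ {S} → automaton-correct φ f ρ (extend S σ))
    automaton-correct (allS φ)  f ρ σ = ⇔.trans (forallSet-accepts (automaton φ) f ρ σ)
                                                (∀-cong-↔ (↔-id _) λ {S} → automaton-correct φ f ρ (extend S σ))

open WordAutomata

module UnitCells where

  open import Data.Integer as ℤ using (+_)
  import Data.Integer.Properties as ℤP
  open import Data.Rational
  open import Data.Rational.Properties
  import Data.Rational.Unnormalised as ℚᵘ
  open import Data.Rational.Unnormalised.Properties using () renaming (≃-sym to ≃ᵘ-sym; ≃-trans to ≃ᵘ-trans)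
  import Data.Nat.Coprimality as Coprime
  open import Data.Rational.Solver using (module +-*-Solver)
  open import Relation.Binary.Definitions using (Trichotomous; Irreflexive; Asymmetric)
  open +-*-Solver

  strictMono-reflects : ∀ {A B : Set} {_<₁_ : A → A → Set} {_<₂_ : B → B → Set} →
    Trichotomous _≡_ _<₁_ → Irreflexive _≡_ _<₂_ → Asymmetric _<₂_ →
    (f : A → B) → (∀ {a b} → a <₁ b → f a <₂ f b) → ∀ {a b} → f a <₂ f b → a <₁ b
  strictMono-reflects compare irrefl asym f mono {a} {b} fa<fb with compare a b
  ... | tri< a<b _ _  = a<b
  ... | tri≈ _ refl _ = ⊥-elim (irrefl refl fa<fb)
  ... | tri> _ _ b<a  = ⊥-elim (asym fa<fb (mono b<a))

  Open01 : ℚ → Set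
  Open01 v = 0ℚ < v × v < 1ℚ

  -- ℕtoℚ n normalises only for closed n, so we pass to its normal form, which is already coprime.
  integer : ℕ → ℚ
  integer n = mkℚ (+ n) 0 (Coprime.sym (Coprime.1-coprimeTo n))

  ℕtoℚ≡integer : ∀ n → ℕtoℚ n ≡ integer n
  ℕtoℚ≡integer n = ↥p/↧p≡p (integer n)

  ℕtoℚ-suc : ∀ n → ℕtoℚ (suc n) ≡ ℕtoℚ n + 1ℚ
  ℕtoℚ-suc n rewrite ℕtoℚ≡integer n | ℕtoℚ≡integer (suc n) =
    toℚᵘ-injective (≃ᵘ-sym (≃ᵘ-trans (toℚᵘ-homo-+ (integer n) 1ℚ) (ℚᵘ.*≡* numerators)))
    where
    numerators : ((+ n ℤ.* + 1) ℤ.+ (+ 1 ℤ.* + 1)) ℤ.* + 1 ≡ + suc n ℤ.* (+ 1 ℤ.* + 1)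
    numerators = trans (ℤP.*-identityʳ _) (trans (cong (ℤ._+ + 1) (ℤP.*-identityʳ (+ n)))
           (trans (cong +_ (ℕP.+-comm n 1)) (sym (ℤP.*-identityʳ (+ suc n)))))

  ℕtoℚ-mono-≤ : ∀ {m n} → m ℕ.≤ n → ℕtoℚ m ≤ ℕtoℚ n
  ℕtoℚ-mono-≤ {m} {n} m≤n rewrite ℕtoℚ≡integer m | ℕtoℚ≡integer n =
    *≤* (subst₂ ℤ._≤_ (sym (ℤP.*-identityʳ (+ m))) (sym (ℤP.*-identityʳ (+ n))) (ℤ.+≤+ m≤n))

  ℕtoℚ-<⇒+1≤ : ∀ {m n} → m ℕ.< n → ℕtoℚ m + 1ℚ ≤ ℕtoℚ n
  ℕtoℚ-<⇒+1≤ {m} m<n = subst (_≤ _) (ℕtoℚ-suc m) (ℕtoℚ-mono-≤ m<n)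

  cell-<⇐ : ∀ {m n v v′} → Open01 v → Open01 v′ → m ℕ.< n ⊎ (m ≡ n × v < v′) → ℕtoℚ m + v < ℕtoℚ n + v′
  cell-<⇐ {m} {n} {v} {v′} (_ , v<1) (0<v′ , _) (inj₁ m<n) = begin-strict
    ℕtoℚ m + v      <⟨ +-monoʳ-< (ℕtoℚ m) v<1 ⟩
    ℕtoℚ m + 1ℚ     ≤⟨ ℕtoℚ-<⇒+1≤ m<n ⟩
    ℕtoℚ n          ≡⟨ +-identityʳ (ℕtoℚ n) ⟨
    ℕtoℚ n + 0ℚ     <⟨ +-monoʳ-< (ℕtoℚ n) 0<v′ ⟩
    ℕtoℚ n + v′     ∎
    where open ≤-Reasoning
  cell-<⇐ {m} _ _ (inj₂ (refl , v<v′)) = +-monoʳ-< (ℕtoℚ m) v<v′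

  cell-< : ∀ {m n v v′} → Open01 v → Open01 v′ → (ℕtoℚ m + v < ℕtoℚ n + v′) ⇔ (m ℕ.< n ⊎ (m ≡ n × v < v′))
  cell-< {m} {n} hv hv′ = mk⇔ split (cell-<⇐ hv hv′)
    where
    split : _ → m ℕ.< n ⊎ (m ≡ n × _)
    split lt with ℕP.<-cmp m n
    ... | tri< m<n _ _  = inj₁ m<n
    ... | tri≈ _ refl _ =
      inj₂ (refl , strictMono-reflects <-cmp <-irrefl <-asym (λ v → ℕtoℚ m + v) (+-monoʳ-< (ℕtoℚ m)) lt)
    ... | tri> _ _ n<m  = ⊥-elim (<-asym lt (cell-<⇐ hv′ hv (inj₁ n<m)))

  flipBy : Sign → ℚ → ℚ
  flipBy s+ v = v
  flipBy s- v = 1ℚ - v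

  flipBy-involutive : ∀ s v → flipBy s (flipBy s v) ≡ v
  flipBy-involutive s+ v = refl
  flipBy-involutive s- v = solve 1 (λ v → con 1ℚ :- (con 1ℚ :- v) := v) refl v

  flipBy-· : ∀ s t v → flipBy (s · t) v ≡ flipBy s (flipBy t v)
  flipBy-· s+ t  v = refl
  flipBy-· s- s+ v = refl
  flipBy-· s- s- v = sym (flipBy-involutive s- v)

  1-anti-< : ∀ {u v} → u < v → 1ℚ - v < 1ℚ - u
  1-anti-< u<v = +-monoʳ-< 1ℚ (neg-antimono-< u<v)

  flipBy-Open01 : ∀ s {v} → Open01 v → Open01 (flipBy s v)
  flipBy-Open01 s+ hv = hv
  flipBy-Open01 s- (0<v , v<1) = 1-anti-< v<1 , 1-anti-< 0<v

  flipBy-< : ∀ s {u v} → (flipBy s u < flipBy s v) ⇔ Oriented s _<_ u v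
  flipBy-< s+ = mk⇔ (λ lt → lt) (λ lt → lt)
  flipBy-< s- {u} {v} = mk⇔ (λ lt → subst₂ _<_ (flipBy-involutive s- v) (flipBy-involutive s- u) (1-anti-< lt)) 1-anti-<

  segment-y : ∀ {m} s → m ≡ signEntry s → ∀ r t y →
    ((m ≡ e1 × y ≡ r + t) ⊎ (m ≡ e-1 × y ≡ (r + 1ℚ) - t)) ⇔ (y ≡ r + flipBy s t)
  segment-y s+ refl r t y = mk⇔ (λ { (inj₁ (_ , y≡)) → y≡ ; (inj₂ (() , _)) }) (λ y≡ → inj₁ (refl , y≡))
  segment-y s- refl r t y = mk⇔ (λ { (inj₁ (() , _)) ; (inj₂ (_ , y≡)) → trans y≡ (regroup r t) })
                                (λ y≡ → inj₂ (refl , trans y≡ (sym (regroup r t))))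
    where
    regroup : ∀ r t → (r + 1ℚ) - t ≡ r + (1ℚ - t)
    regroup = solve 2 (λ r t → (r :+ con 1ℚ) :- t := r :+ (con 1ℚ :- t)) refl

  segment-nonzero : ∀ {m} r t {y} → ((m ≡ e1 × y ≡ r + t) ⊎ (m ≡ e-1 × y ≡ (r + 1ℚ) - t)) → m ≢ e0
  segment-nonzero r t (inj₁ (refl , _)) ()
  segment-nonzero r t (inj₂ (refl , _)) ()

  increasing01 : ℕ → Σ ℚ Open01
  increasing01 zero    with v , 0<v , v<1 ← <-dense (*<* (ℤ.+<+ (ℕ.s≤s ℕ.z≤n))) = v , 0<v , v<1
  increasing01 (suc k) with v , 0<v , v<1 ← increasing01 k with v′ , v<v′ , v′<1 ← <-dense v<1 =
    v′ , <-trans 0<v v<v′ , v′<1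

  increasing01-suc : ∀ k → proj₁ (increasing01 k) < proj₁ (increasing01 (suc k))
  increasing01-suc k = proj₁ (proj₂ (<-dense (proj₂ (proj₂ (increasing01 k)))))

  increasing01-mono : ∀ {k m} → k ℕ.< m → proj₁ (increasing01 k) < proj₁ (increasing01 m)
  increasing01-mono {k} {suc m} (ℕ.s≤s k≤m) with ℕP.m≤n⇒m<n∨m≡n k≤m
  ... | inj₁ k<m  = <-trans (increasing01-mono k<m) (increasing01-suc m)
  ... | inj₂ refl = increasing01-suc k

open UnitCells

module SortingByKey where

  open import Data.Fin.Permutation using (_⟨$⟩ʳ_; _⟨$⟩ˡ_; inverseˡ; inverseʳ)
  open import Data.List as L using (length; allFin)
  import Data.List.Properties as LP
  open import Data.Rational using (ℚ; _≤_)
  import Data.Rational.Properties as ℚP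
  import Relation.Binary.Construct.On as On
  open import Relation.Binary.Bundles using (DecTotalOrder)
  open import Data.List.Relation.Binary.Permutation.Propositional using (↭⇒↭ₛ)
  open import Data.List.Relation.Binary.Permutation.Setoid.Properties using (onIndices-lookup)
  open import Data.List.Relation.Binary.Permutation.Homogeneous using (onIndices)
  import Data.List.Sort as Sort
  open import Data.List.Relation.Unary.Sorted.TotalOrder.Properties using (lookup-mono-≤)

  record Sorting {n : ℕ} (key : Fin n → ℚ) : Set where
    field
      len       : ℕ
      at        : Fin len → Fin n
      rank      : Fin n → Fin len
      rank-at   : ∀ k → rank (at k) ≡ k
      at-rank   : ∀ i → at (rank i) ≡ i
      ascending : ∀ {k k′} → k F.≤ k′ → key (at k) ≤ key (at k′)

  sorting : ∀ {n} (key : Fin n → ℚ) → Sorting key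
  sorting {n} key = record
    { len = length sorted ; at = L.lookup sorted ; rank = rank ; rank-at = rank-at ; at-rank = at-rank
    ; ascending = lookup-mono-≤ (DecTotalOrder.totalOrder byKey) (sort-↗ (allFin n)) }
    where
    byKey : DecTotalOrder _ _ _
    byKey = On.decTotalOrder ℚP.≤-decTotalOrder key
    open Sort byKey using (sort; sort-↭; sort-↗)
    sorted = sort (allFin n)
    π = onIndices (↭⇒↭ₛ (sort-↭ (allFin n)))
    length-allFin : length (allFin n) ≡ n
    length-allFin = LP.length-tabulate (λ i → i)
    lookup-allFin : ∀ j → L.lookup (allFin n) j ≡ F.cast length-allFin j
    lookup-allFin j = trans (cong (L.lookup (allFin n)) (sym (FP.cast-involutive (sym length-allFin) length-allFin j)))
                            (LP.lookup-tabulate (λ i → i) (F.cast length-allFin j))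
    lookup-sorted : ∀ k → L.lookup sorted k ≡ F.cast length-allFin (π ⟨$⟩ʳ k)
    lookup-sorted k = trans (onIndices-lookup (setoid (Fin n)) (↭⇒↭ₛ (sort-↭ (allFin n))) k) (lookup-allFin _)
    rank : Fin n → Fin (length sorted)
    rank i = π ⟨$⟩ˡ F.cast (sym length-allFin) i
    rank-at : ∀ k → rank (L.lookup sorted k) ≡ k
    rank-at k = trans (cong (λ z → π ⟨$⟩ˡ F.cast (sym length-allFin) z) (lookup-sorted k))
                  (trans (cong (π ⟨$⟩ˡ_) (FP.cast-involutive (sym length-allFin) length-allFin _)) (inverseˡ π))
    at-rank : ∀ i → L.lookup sorted (rank i) ≡ i
    at-rank i = trans (lookup-sorted _)
                  (trans (cong (F.cast length-allFin) (inverseʳ π)) (FP.cast-involutive length-allFin (sym length-allFin) i))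

open SortingByKey

module GeometricRealisation where

  open import Data.Rational as ℚ using (ℚ; _<_; _≤_; _+_)
  import Data.Rational.Properties as ℚP

  module Coordinates {n k : ℕ} (line : Fin n → Fin k) (sg : Fin k → Sign)
                     (u : Fin n → ℚ) (open01 : ∀ i → Open01 (u i))
                     (ordered : ∀ i j → line i ≡ line j → u i < u j ⇔ i F.< j) where

    coordinate : Fin n → ℚ
    coordinate i = ℕtoℚ (toℕ (line i)) + flipBy (sg (line i)) (u i)

    oriented : ∀ s i j → line i ≡ line j → Oriented s _<_ (u i) (u j) ⇔ Oriented s F._<_ i j
    oriented s+ i j same = ordered i j same
    oriented s- i j same = ordered j i (sym same)

    sameLine : ∀ i j → (toℕ (line i) ≡ toℕ (line j) × flipBy (sg (line i)) (u i) < flipBy (sg (line j)) (u j))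
                     ⇔ (line i ≡ line j × Oriented (sg (line i)) F._<_ i j)
    sameLine i j = mk⇔
      (λ (same , lt) → let same′ = FP.toℕ-injective same in
        same′ , to (oriented s i j same′)
                   (to (flipBy-< s) (subst (λ c → flipBy s (u i) < flipBy (sg c) (u j)) (sym same′) lt)))
      (λ (same , o) → cong toℕ same ,
        subst (λ c → flipBy s (u i) < flipBy (sg c) (u j)) same (from (flipBy-< s) (from (oriented s i j same) o)))
      where
      s = sg (line i)

    coordinate-< : ∀ i j → coordinate i < coordinate j ⇔ LineOrder sg (line i) (line j) i j
    coordinate-< i j =
      ⇔.trans (cell-< (flipBy-Open01 (sg (line i)) (open01 i)) (flipBy-Open01 (sg (line j)) (open01 j)))
              (⇔.refl ⊎-⇔ sameLine i j)

    coordinate-injective : ∀ {i j} → coordinate i ≡ coordinate j → i ≡ j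
    coordinate-injective {i} {j} same with i F.≟ j
    ... | yes i≡j = i≡j
    ... | no i≢j with LineOrder-total sg (line i) (line j) i≢j
    ...   | inj₁ o = ⊥-elim (ℚP.<-irrefl same (from (coordinate-< i j) o))
    ...   | inj₂ o = ⊥-elim (ℚP.<-irrefl (sym same) (from (coordinate-< j i) o))

  ascending-ordered : ∀ {n k} (line : Fin n → Fin k) (u : Fin n → ℚ) →
    (∀ {a b} → a F.≤ b → u a ≤ u b) → (∀ a b → line a ≡ line b → u a ≡ u b → a ≡ b) →
    ∀ a b → line a ≡ line b → u a < u b ⇔ a F.< b
  ascending-ordered line u ascending injective a b same = mk⇔ sound complete
    where
    sound : u a < u b → a F.< b
    sound lt with FP.<-cmp a b
    ... | tri< a<b _ _  = a<b
    ... | tri≈ _ refl _ = ⊥-elim (ℚP.<-irrefl refl lt)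
    ... | tri> _ _ b<a  = ⊥-elim (ℚP.<-irrefl refl (ℚP.<-≤-trans lt (ascending (ℕP.<⇒≤ b<a))))
    complete : a F.< b → u a < u b
    complete a<b with ℚP.<-cmp (u a) (u b)
    ... | tri< lt _ _ = lt
    ... | tri≈ _ ua≡ub _ = ⊥-elim (FP.<-irrefl (injective a b same ua≡ub) a<b)
    ... | tri> _ _ gt = ⊥-elim (ℚP.<-irrefl refl (ℚP.≤-<-trans (ascending (ℕP.<⇒≤ a<b)) gt))

  module Realisation {w h : ℕ} (M : Matrix w h) (cs : Fin w → Sign) (rs : Fin h → Sign) (pmm : IsPMMWith M cs rs) where
    open Words cs rs

    NonzeroWord : ∀ {n} → (Fin n → Cell) → Set
    NonzeroWord f = ∀ i → M (column (f i)) (row (f i)) ≢ e0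

    onSegment : ∀ c r → M c r ≢ e0 → ∀ t y →
      ((M c r ≡ e1 × y ≡ ℕtoℚ (toℕ r) + t) ⊎ (M c r ≡ e-1 × y ≡ (ℕtoℚ (toℕ r) + ℚ.1ℚ) ℚ.- t))
      ⇔ (y ≡ ℕtoℚ (toℕ r) + flipBy (rs r) (flipBy (cs c) t))
    onSegment c r nonzero t y rewrite sym (flipBy-· (rs r) (cs c) t) =
      segment-y (rs r · cs c) (pmm c r nonzero) (ℕtoℚ (toℕ r)) t y

    module WordRealisation {n} (f : Fin n → Cell) (nonzero : NonzeroWord f) where

      u : Fin n → ℚ
      u i = proj₁ (increasing01 (toℕ i))

      open01 : ∀ i → Open01 (u i)
      open01 i = proj₂ (increasing01 (toℕ i))

      ordered : ∀ {k} (line : Fin n → Fin k) i j → line i ≡ line j → u i < u j ⇔ i F.< j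
      ordered _ i j _ = mk⇔ (strictMono-reflects FP.<-cmp ℚP.<-irrefl ℚP.<-asym u increasing01-mono) increasing01-mono

      module X = Coordinates (column ∘ f) cs u open01 (ordered (column ∘ f))
      module Y = Coordinates (row ∘ f) rs u open01 (ordered (row ∘ f))

      onFigure : ∀ i → OnFigure M (X.coordinate i , Y.coordinate i)
      onFigure i = c , r , t , proj₁ t∈01 , proj₂ t∈01 , refl ,
                   from (onSegment c r (nonzero i) t _)
                        (cong (λ v → ℕtoℚ (toℕ r) + flipBy (rs r) v) (sym (flipBy-involutive (cs c) (u i))))
        where
        c = column (f i)
        r = row (f i)
        t = flipBy (cs c) (u i)
        t∈01 = flipBy-Open01 (cs c) (open01 i)

      pointSet : GeomPointSet M
      pointSet = record
        { n = n ; pt = λ i → X.coordinate i , Y.coordinate i ; onFig = onFigure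
        ; distX = λ i j i≢j → i≢j ∘ X.coordinate-injective
        ; distY = λ i j i≢j → i≢j ∘ Y.coordinate-injective }

      pointSet≅wordPerm : permOf pointSet ≅ wordPerm f
      pointSet≅wordPerm = record
        { points = mk↔ₛ′ (λ i → i) (λ i → i) (λ _ → refl) (λ _ → refl)
        ; <₁-cong = X.coordinate-< ; <₂-cong = Y.coordinate-< }

    module PointSetWord (P : GeomPointSet M) where
      open GeomPointSet P

      cellOf : Fin n → Cell
      cellOf i = proj₁ (onFig i) , proj₁ (proj₂ (onFig i))

      param : Fin n → ℚ
      param i = proj₁ (proj₂ (proj₂ (onFig i)))

      u : Fin n → ℚ
      u i = flipBy (cs (column (cellOf i))) (param i)

      open01 : ∀ i → Open01 (u i)
      open01 i = let (_ , _ , _ , 0<t , t<1 , _) = onFig i in flipBy-Open01 (cs (column (cellOf i))) (0<t , t<1)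

      nonzero : NonzeroWord cellOf
      nonzero i = let (_ , _ , _ , _ , _ , _ , y∈segment) = onFig i in
        segment-nonzero (ℕtoℚ (toℕ (row (cellOf i)))) (param i) y∈segment

      x-coordinate : ∀ i → proj₁ (pt i) ≡ ℕtoℚ (toℕ (column (cellOf i))) + flipBy (cs (column (cellOf i))) (u i)
      x-coordinate i = let (_ , _ , _ , _ , _ , x≡ , _) = onFig i in
        trans x≡ (cong (ℕtoℚ (toℕ (column (cellOf i))) +_) (sym (flipBy-involutive (cs (column (cellOf i))) (param i))))

      y-coordinate : ∀ i → proj₂ (pt i) ≡ ℕtoℚ (toℕ (row (cellOf i))) + flipBy (rs (row (cellOf i))) (u i)
      y-coordinate i = let (_ , _ , _ , _ , _ , _ , y∈segment) = onFig i in
        to (onSegment (column (cellOf i)) (row (cellOf i)) (nonzero i) (param i) (proj₂ (pt i))) y∈segment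

      open Sorting (sorting u)

      word : Fin len → Cell
      word = cellOf ∘ at

      nonzeroWord : NonzeroWord word
      nonzeroWord = nonzero ∘ at

      module Axis {k : ℕ} (line : Cell → Fin k) (sg : Fin k → Sign) (coord : ℚ × ℚ → ℚ)
        (coord≡ : ∀ i → coord (pt i) ≡ ℕtoℚ (toℕ (line (cellOf i))) + flipBy (sg (line (cellOf i))) (u i))
        (distinct : ∀ i j → i ≢ j → coord (pt i) ≢ coord (pt j)) where

        injective : ∀ a b → line (word a) ≡ line (word b) → u (at a) ≡ u (at b) → a ≡ b
        injective a b same u≡ with at a F.≟ at b
        ... | yes at≡ = trans (sym (rank-at a)) (trans (cong rank at≡) (rank-at b))
        ... | no at≢ = ⊥-elim (distinct (at a) (at b) at≢
              (trans (coord≡ (at a))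
                     (trans (cong₂ (λ c v → ℕtoℚ (toℕ c) + flipBy (sg c) v) same u≡) (sym (coord≡ (at b))))))

        open Coordinates (line ∘ word) sg (u ∘ at) (open01 ∘ at) (ascending-ordered (line ∘ word) (u ∘ at) ascending injective)

        <-cong : ∀ a b → LineOrder sg (line (word a)) (line (word b)) a b ⇔ coord (pt (at a)) < coord (pt (at b))
        <-cong a b = mk⇔ (λ o → subst₂ _<_ (sym (coord≡ (at a))) (sym (coord≡ (at b))) (from (coordinate-< a b) o))
                         (λ lt → to (coordinate-< a b) (subst₂ _<_ (coord≡ (at a)) (coord≡ (at b)) lt))

      wordPerm≅pointSet : wordPerm word ≅ permOf P
      wordPerm≅pointSet = record
        { points = mk↔ₛ′ at rank at-rank rank-at
        ; <₁-cong = Axis.<-cong column cs proj₁ x-coordinate distX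
        ; <₂-cong = Axis.<-cong row rs proj₂ y-coordinate distY }

    InThGeom⇔wordsSatisfy : ∀ θ → InThGeom θ M ⇔ (∀ n (f : Fin n → Cell) → NonzeroWord f → wordPerm f ⊨ θ)
    InThGeom⇔wordsSatisfy θ = mk⇔
      (λ inTh n f nonzero → let open WordRealisation f nonzero in to (⊨-≅ pointSet≅wordPerm θ) (inTh pointSet))
      (λ satisfy P → let open PointSetWord P in to (⊨-≅ wordPerm≅pointSet θ) (satisfy _ word nonzeroWord))

    noElements : ∀ {n} → Fin 0 → Fin n
    noElements ()

    noSets : ∀ {n} → Fin 0 → Subset n
    noSets ()

    isZero : Entry → Bool
    isZero e0  = true
    isZero e1  = false
    isZero e-1 = false

    T-isZero : ∀ m → T (isZero m) ⇔ m ≡ e0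
    T-isZero e0  = mk⇔ (λ _ → refl) (λ _ → _)
    T-isZero e1  = mk⇔ (λ ()) (λ ())
    T-isZero e-1 = mk⇔ (λ ()) (λ ())

    onZeroCell : Letter 0 0 → Bool
    onZeroCell l = isZero (M (column (cell l)) (row (cell l)))

    counterexamples : Sentence → DFA (Letter 0 0)
    counterexamples θ = product _∧_ (complement (someLetter onZeroCell)) (complement (automaton θ))

    annotate-cell : ∀ {n} (u : Fin n → Letter 0 0) i → annotate (cell ∘ u) noElements noSets i ≡ u i
    annotate-cell u i with u i
    ... | c , [] , [] = refl

    ⊨⇔accepts : ∀ θ {n} (f : Fin n → Cell) → wordPerm f ⊨ θ ⇔ T (accepts (automaton θ) (annotate f noElements noSets))
    ⊨⇔accepts θ f = ⇔.trans (⊨⇔Sat (wordPerm f) θ) (⇔.sym (automaton-correct θ f noElements noSets))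

    counterexamples-accepts : ∀ θ {n} (f : Fin n → Cell) →
      T (accepts (counterexamples θ) (annotate f noElements noSets)) ⇔ (NonzeroWord f × ¬ wordPerm f ⊨ θ)
    counterexamples-accepts θ f =
      ⇔.trans (product-∧ (complement (someLetter onZeroCell)) (complement (automaton θ)) W)
              (nonzero⇔ ×-⇔ ⇔.trans (complement-accepts (automaton θ) W) (¬-cong-⇔ (⇔.sym (⊨⇔accepts θ f))))
      where
      W = annotate f noElements noSets
      nonzero⇔ : T (accepts (complement (someLetter onZeroCell)) W) ⇔ NonzeroWord f
      nonzero⇔ = ⇔.trans (complement-accepts (someLetter onZeroCell) W) (mk⇔
        (λ ¬zero i m≡e0 → ¬zero (from (someLetter-accepts onZeroCell W) (i , from (T-isZero _) m≡e0)))
        (λ nonzero t → let i , onZero = to (someLetter-accepts onZeroCell W) t in nonzero i (to (T-isZero _) onZero)))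

    wordsSatisfy⇔noCounterexample : ∀ θ →
      (∀ n (f : Fin n → Cell) → NonzeroWord f → wordPerm f ⊨ θ) ⇔ (¬ NonEmpty (counterexamples θ))
    wordsSatisfy⇔noCounterexample θ = mk⇔
      (λ satisfy (n , u , t) →
        let nonzero , ¬sat = to (counterexamples-accepts θ (cell ∘ u))
                                (subst T (sym (accepts-cong (counterexamples θ) (annotate-cell u))) t)
        in ¬sat (satisfy n (cell ∘ u) nonzero))
      (λ none n f nonzero → decidable-stable (Decidable.map (⇔.sym (⊨⇔accepts θ f)) (T? _))
        (λ ¬sat → none (n , annotate f noElements noSets , from (counterexamples-accepts θ f) (nonzero , ¬sat))))

open GeometricRealisation

mainTheorem6 : ∀ {w h} (M : Matrix w h) (cs : Fin w → Sign) (rs : Fin h → Sign) →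
    IsPMMWith M cs rs → (θ : Sentence) → Dec (InThGeom θ M)
mainTheorem6 M cs rs pmm θ =
  Decidable.map (⇔.sym (⇔.trans (InThGeom⇔wordsSatisfy θ) (wordsSatisfy⇔noCounterexample θ)))
      (¬? (Emptiness.nonEmpty? (finite-Letter 0 0) (counterexamples θ)))
  where
  open Words cs rs
  open Realisation M cs rs pmm
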